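{- Let $3T_2^2$ denote the $2\times 3$ matrix all of whose columns equal $(1,1)^T$. Then $\mathrm{sat}(5,3T_2^2)=12$.
   Context: All matrices are $0$-$1$ matrices. A matrix is simple if it has no repeated columns. A matrix $F$ is a submatrix of $A$ if, after deleting some rows and columns of $A$, one obtains a row and column permutation of $F$. A simple $n$-row matrix $M$ is $F$-saturated if it does not contain $F$ as a submatrix but appending any $n$-column not already a column of $M$ produces a matrix containing $F$; $\mathrm{sat}(n,F)$ is the minimum number of columns of an $F$-saturated $n$-row matrix. -}

module Defs where

open import Data.Nat using (ℕ; suc; _≤_)
open import Data.Bool using (Bool; true)
open import Data.Fin using (Fin; zero; suc)
open import Data.Vec using (Vec; lookup)
open import Data.Product using (Σ; ∃; _×_)
open import Relation.Nullary using (¬_)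
open import Relation.Binary.PropositionalEquality using (_≡_; _≢_)
open import Function.Definitions using (Injective)

-- A 0-1 matrix with n rows and k columns, given by its list of columns.
-- Each column is a vector in {0,1}^n (false = 0, true = 1).
Matrix : ℕ → ℕ → Set
Matrix n k = Fin k → Vec Bool n

entry : ∀ {n k} → Matrix n k → Fin n → Fin k → Bool
entry A i j = lookup (A j) i

Simple : ∀ {n k} → Matrix n k → Set
Simple A = Injective _≡_ _≡_ A

-- F (p × q) is a submatrix of A (m × k): there are an injective choice of
-- rows and an injective choice of columns of A (in some order, which
-- accounts for row/column permutations of F) reproducing F entrywise.
Contains : ∀ {m k p q} → Matrix m k → Matrix p q → Set
Contains {m} {k} {p} {q} A F =
  Σ (Fin p → Fin m) λ r → Σ (Fin q → Fin k) λ c →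
    Injective _≡_ _≡_ r × Injective _≡_ _≡_ c ×
    (∀ i j → entry A (r i) (c j) ≡ entry F i j)

append : ∀ {n k} → Matrix n k → Vec Bool n → Matrix n (suc k)
append A v zero    = v
append A v (suc j) = A j

Saturated : ∀ {n k p q} → Matrix p q → Matrix n k → Set
Saturated {n} F M =
  Simple M × ¬ Contains M F ×
  (∀ (v : Vec Bool n) → (∀ j → M j ≢ v) → Contains (append M v) F)

SatIs : ∀ {p q} → ℕ → Matrix p q → ℕ → Set
SatIs n F s =
  (Σ (Matrix n s) λ M → Saturated F M) ×
  (∀ k (M : Matrix n k) → Saturated F M → s ≤ k)

threeT22 : Matrix 2 3
threeT22 j = Data.Vec.replicate 2 true

module Submission where

-- A copy of 3T₂² is a pair of rows together with three columns having ones in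
-- both rows.  Hence a simple matrix M avoids 3T₂² iff every pair of distinct
-- rows has at most two common columns ("pairwise sparse"), and appending a new
-- column v creates a copy iff v has ones in some pair of rows that already has
-- two common columns in M ("v is completable").  This turns saturation into a
-- counting condition on the set of columns of M.
--
-- Lower bound: the columns of a saturated 5-row matrix form a family S of
-- subsets of {0,…,4} in which no pair of points is covered three times, while
-- every non-member contains a pair covered twice.  A verified exhaustive
-- search over the 32 candidate members shows that every such family has at
-- least 12 members, and since M is simple it has at least |S| columns.
-- Upper bound: an explicit 12-column matrix is checked to be saturated.

open import Defs
open import Data.Nat using (ℕ; zero; suc; _≤_; _^_; _≤?_; z≤n; s≤s; s≤s⁻¹)
open import Data.Nat.Properties using (≤-refl; ≤-trans; ≰⇒>)
open import Data.Bool using (Bool; true; false; _∧_; _∨_)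
open import Data.Bool.Properties using (∧-conicalˡ; ∧-conicalʳ)
import Data.Bool.Properties as Bool
open import Data.Fin using (Fin; zero; suc; lift; quotient; remainder; combine; _≟_)
open import Data.Fin.Properties
  using (any?; all?; 0≢1+n; suc-injective; lift-injective; remQuot-combine; combine-remQuot)
open import Data.Fin.Subset using (Subset; _∈_; _∉_; _⊆_; ∣_∣; _∩_; _∪_; ∁; ⁅_⁆; ⊥; _-_)
open import Data.Fin.Subset.Properties
  using ( _∈?_; ∈⊤; ∉⊥; ∣⊤∣≡n; p⊆q⇒∣p∣≤∣q∣; x∈p⇒∣p-x∣<∣p∣; x∈p∧x≢y⇒x∈p-y
        ; x∈p∩q⁺; x∈p∩q⁻; x∈p∪q⁻; x∈⁅y⁆⇒x≡y
        ; x∈p⇒x∉∁p; x∉p⇒x∈∁p; x∈∁p⇒x∉p )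
open import Data.Vec using (Vec; []; _∷_; lookup; tabulate; here; there)
open import Data.Vec.Properties using (lookup∘tabulate; lookup⇒[]=; []=⇒lookup; ≡-dec)
open import Data.List using (List; []; _∷_; allFin; filter; _++_)
open import Data.Product using (Σ; ∃; ∃₂; _×_; _,_; proj₁; proj₂)
open import Data.Sum using (_⊎_; inj₁; inj₂)
open import Relation.Nullary using (¬_; Dec; yes; no; does; contradiction)
open import Relation.Nullary.Decidable using (_⊎-dec_; _×-dec_; ¬?; _→-dec_; dec-true)
open import Function using (_∘_)
open import Relation.Binary.PropositionalEquality
  using (_≡_; _≢_; refl; sym; trans; cong; cong₂; subst; module ≡-Reasoning)
open import Function.Definitions using (Injective)

private
  variable
    m n k : ℕ

decided : ∀ {A : Set} (d : Dec A) → does d ≡ true → A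
decided (yes a) _ = a

∈-tabulate⁺ : ∀ (f : Fin n → Bool) {x} → f x ≡ true → x ∈ tabulate f
∈-tabulate⁺ f {x} fx = lookup⇒[]= x (tabulate f) (trans (lookup∘tabulate f x) fx)

∈-tabulate⁻ : ∀ (f : Fin n → Bool) {x} → x ∈ tabulate f → f x ≡ true
∈-tabulate⁻ f {x} x∈ = trans (sym (lookup∘tabulate f x)) ([]=⇒lookup x∈)

distinct⇒≤∣∣ : ∀ {p : Subset n} (g : Fin m → Fin n) →
               Injective _≡_ _≡_ g → (∀ x → g x ∈ p) → m ≤ ∣ p ∣
distinct⇒≤∣∣ {m = zero}  g g-inj g∈p = z≤n
distinct⇒≤∣∣ {m = suc m} {p = p} g g-inj g∈p =
  ≤-trans (s≤s rest) (x∈p⇒∣p-x∣<∣p∣ (g∈p zero))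
  where
  rest : m ≤ ∣ p - g zero ∣
  rest = distinct⇒≤∣∣ (λ x → g (suc x)) (λ e → suc-injective (g-inj e))
           (λ x → x∈p∧x≢y⇒x∈p-y (g∈p (suc x)) (λ e → 0≢1+n (sym (g-inj e))))

enumerate : ∀ (p : Subset n) → m ≤ ∣ p ∣ →
            Σ (Fin m → Fin n) λ g → Injective _≡_ _≡_ g × (∀ x → g x ∈ p)
enumerate {m = zero}  []         _ = (λ ()) , (λ { {()} }) , λ ()
enumerate {m = suc _} []         ()
enumerate             (false ∷ p) m≤∣p∣ =
  let g , g-inj , g∈p = enumerate p m≤∣p∣
  in (λ x → suc (g x)) , (λ e → g-inj (suc-injective e)) , λ x → there (g∈p x)
enumerate {m = zero}  (true ∷ p)  _ = (λ ()) , (λ { {()} }) , λ ()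
enumerate {m = suc m} (true ∷ p)  m≤∣p∣ =
  let g , g-inj , g∈p = enumerate p (s≤s⁻¹ m≤∣p∣)
  in lift 1 g , lift-injective g g-inj 1 , λ { zero → here ; (suc x) → there (g∈p x) }

≤∣∣-by-injection : ∀ {p : Subset n} {q : Subset m} (f : ∀ x → x ∈ p → Fin m) →
                   (∀ {x y} x∈p y∈p → f x x∈p ≡ f y y∈p → x ≡ y) →
                   (∀ x x∈p → f x x∈p ∈ q) → ∣ p ∣ ≤ ∣ q ∣
≤∣∣-by-injection {p = p} f f-inj f∈q with enumerate p ≤-refl
... | g , g-inj , g∈p =
  distinct⇒≤∣∣ (λ x → f (g x) (g∈p x)) (λ e → g-inj (f-inj (g∈p _) (g∈p _) e))
               (λ x → f∈q (g x) (g∈p x))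

bothOnes : Vec Bool n → Fin n → Fin n → Bool
bothOnes v a b = lookup v a ∧ lookup v b

common : Matrix n k → Fin n → Fin n → Subset k
common M a b = tabulate λ j → bothOnes (M j) a b

∈-common⁺ : ∀ (M : Matrix n k) {a b j} →
            lookup (M j) a ≡ true → lookup (M j) b ≡ true → j ∈ common M a b
∈-common⁺ M {a} {b} Mja Mjb = ∈-tabulate⁺ (λ j → bothOnes (M j) a b) (both Mja Mjb)
  where
  both : ∀ {x y} → x ≡ true → y ≡ true → x ∧ y ≡ true
  both refl refl = refl

∈-common⁻ : ∀ (M : Matrix n k) {a b j} → j ∈ common M a b →
            lookup (M j) a ≡ true × lookup (M j) b ≡ true
∈-common⁻ M {a} {b} {j} j∈ = ∧-conicalˡ _ _ both , ∧-conicalʳ _ _ both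
  where both = ∈-tabulate⁻ (λ j → bothOnes (M j) a b) j∈

PairwiseSparse : Matrix n k → Set
PairwiseSparse {n} M = ∀ (a b : Fin n) → a ≢ b → ∣ common M a b ∣ ≤ 2

Completable : Matrix n k → Vec Bool n → Set
Completable {n} M v =
  ∃₂ λ (a b : Fin n) → a ≢ b × bothOnes v a b ≡ true × 2 ≤ ∣ common M a b ∣

contains⇒crowded : ∀ (M : Matrix n k) → Contains M threeT22 →
                   ∃₂ λ a b → a ≢ b × 3 ≤ ∣ common M a b ∣
contains⇒crowded M (r , c , r-inj , c-inj , r×c≡1) =
  r zero , r (suc zero) , (λ e → 0≢1 (r-inj e)) ,
  distinct⇒≤∣∣ c c-inj (λ j → ∈-common⁺ M (r×c≡1 zero j) (r×c≡1 (suc zero) j))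
  where
  0≢1 : zero ≢ suc zero
  0≢1 ()

crowded⇒contains : ∀ (M : Matrix n k) {a b} → a ≢ b → 3 ≤ ∣ common M a b ∣ →
                   Contains M threeT22
crowded⇒contains M {a} {b} a≢b 3≤ with enumerate (common M a b) 3≤
... | g , g-inj , g∈ = rows , g , rows-inj , g-inj , entries
  where
  rows : Fin 2 → Fin _
  rows zero    = a
  rows (suc _) = b

  rows-inj : Injective _≡_ _≡_ rows
  rows-inj {zero}        {zero}        _ = refl
  rows-inj {zero}        {suc zero}    e = contradiction e a≢b
  rows-inj {suc zero}    {zero}        e = contradiction (sym e) a≢b
  rows-inj {suc zero}    {suc zero}    _ = refl

  entries : ∀ i j → entry M (rows i) (g j) ≡ entry threeT22 i j
  entries zero       j = proj₁ (∈-common⁻ M (g∈ j))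
  entries (suc zero) j = proj₂ (∈-common⁻ M (g∈ j))

sparse⇒free : ∀ (M : Matrix n k) → PairwiseSparse M → ¬ Contains M threeT22
sparse⇒free M sparse copy with contains⇒crowded M copy
... | a , b , a≢b , 3≤ = contradiction (≤-trans 3≤ (sparse a b a≢b)) λ { (s≤s (s≤s ())) }

free⇒sparse : ∀ (M : Matrix n k) → ¬ Contains M threeT22 → PairwiseSparse M
free⇒sparse M free a b a≢b with ∣ common M a b ∣ ≤? 2
... | yes ≤2 = ≤2
... | no  ≰2 = contradiction (crowded⇒contains M a≢b (≰⇒> ≰2)) free

-- In a 3T₂²-free matrix, appending v creates a copy iff v is completable.
-- (By definition, common (append M v) a b is bothOnes v a b ∷ common M a b.)
append-contains⇒completable : ∀ (M : Matrix n k) v → ¬ Contains M threeT22 →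
                              Contains (append M v) threeT22 → Completable M v
append-contains⇒completable M v free copy
  with contains⇒crowded (append M v) copy
... | a , b , a≢b , 3≤ with bothOnes v a b in v-ab
...   | true  = a , b , a≢b , v-ab , s≤s⁻¹ 3≤
...   | false = contradiction (crowded⇒contains M a≢b 3≤) free

completable⇒append-contains : ∀ (M : Matrix n k) v → Completable M v →
                              Contains (append M v) threeT22
completable⇒append-contains M v (a , b , a≢b , v-ab , 2≤) =
  crowded⇒contains (append M v) a≢b (subst (λ x → 3 ≤ ∣ x ∷ common M a b ∣) (sym v-ab) (s≤s 2≤))

CountingSaturated : Matrix n k → Set
CountingSaturated {n} M =
  Simple M × PairwiseSparse M × (∀ (v : Vec Bool n) → (∀ j → M j ≢ v) → Completable M v)

saturated⇒counting : ∀ (M : Matrix n k) → Saturated threeT22 M → CountingSaturated M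
saturated⇒counting M (simple , free , saturated) =
  simple , free⇒sparse M free ,
  λ v new → append-contains⇒completable M v free (saturated v new)

counting⇒saturated : ∀ (M : Matrix n k) → CountingSaturated M → Saturated threeT22 M
counting⇒saturated M (simple , sparse , completable) =
  simple , sparse⇒free M sparse ,
  λ v new → completable⇒append-contains M v (completable v new)

-- Index 0 stands for 1, so the enumeration starts with the all-ones vector
-- and runs through {0,1}ⁿ in decreasing lexicographic order.
toBool : Fin 2 → Bool
toBool zero    = true
toBool (suc _) = false

fromBool : Bool → Fin 2
fromBool true  = zero
fromBool false = suc zero

toBool-fromBool : ∀ x → toBool (fromBool x) ≡ x
toBool-fromBool true  = refl
toBool-fromBool false = refl

fromBool-toBool : ∀ i → fromBool (toBool i) ≡ i
fromBool-toBool zero       = refl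
fromBool-toBool (suc zero) = refl

decode : ∀ n → Fin (2 ^ n) → Vec Bool n
decode zero    _ = []
decode (suc n) i = toBool (quotient (2 ^ n) i) ∷ decode n (remainder {2} (2 ^ n) i)

encode : ∀ n → Vec Bool n → Fin (2 ^ n)
encode zero    []      = zero
encode (suc n) (x ∷ v) = combine (fromBool x) (encode n v)

decode-encode : ∀ n v → decode n (encode n v) ≡ v
decode-encode zero    []      = refl
decode-encode (suc n) (x ∷ v) = cong₂ _∷_
  (trans (cong (λ qr → toBool (proj₁ qr)) split) (toBool-fromBool x))
  (trans (cong (λ qr → decode n (proj₂ qr)) split) (decode-encode n v))
  where split = remQuot-combine (fromBool x) (encode n v)

encode-decode : ∀ n i → encode n (decode n i) ≡ i
encode-decode zero    zero = refl
encode-decode (suc n) i    =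
  trans (cong₂ combine (fromBool-toBool (quotient (2 ^ n) i))
                       (encode-decode n (remainder {2} (2 ^ n) i)))
        (combine-remQuot {2} (2 ^ n) i)

decode-injective : ∀ n {i j} → decode n i ≡ decode n j → i ≡ j
decode-injective n {i} {j} e =
  trans (sym (encode-decode n i)) (trans (cong (encode n) e) (encode-decode n j))

Blocks : ℕ → ℕ → Set
Blocks m n = Fin n → Fin n → Subset m

PairFree : Blocks m n → Subset m → Set
PairFree {n = n} B S = ∀ (a b : Fin n) → a ≢ b → ∣ S ∩ B a b ∣ ≤ 2

PairSaturated : Blocks m n → Subset m → Set
PairSaturated {n = n} B S =
  ∀ i → i ∉ S → ∃₂ λ (a b : Fin n) → a ≢ b × i ∈ B a b × 2 ≤ ∣ S ∩ B a b ∣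

∩-monoˡ : ∀ {p q : Subset n} r → p ⊆ q → p ∩ r ⊆ q ∩ r
∩-monoˡ {p = p} r p⊆q x∈ = let x∈p , x∈r = x∈p∩q⁻ p r x∈ in x∈p∩q⁺ (p⊆q x∈p , x∈r)

-- The search explores partial decisions "Y ⊆ S ⊆ ∁ N".  The blocks are given
-- as a table so that, during evaluation, each block is computed only once.
module Search {m n : ℕ} (table : Vec (Vec (Subset m) n) n) where

  block : Blocks m n
  block a b = lookup (lookup table a) b

  -- A partial decision is settled for the target t if it already has t
  -- members, or no pair-free pair-saturated S can extend it: some block
  -- receives three members, or some excluded point lies only in blocks that
  -- keep at most one point that is not excluded.
  Settled : ℕ → Subset m → Subset m → Set
  Settled t Y N =
    t ≤ ∣ Y ∣ ⊎
    (∃₂ λ a b → a ≢ b × 3 ≤ ∣ Y ∩ block a b ∣) ⊎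
    (∃ λ i → i ∈ N × ∀ a b → a ≢ b → i ∈ block a b → ∣ ∁ N ∩ block a b ∣ ≤ 1)

  settled? : ∀ t Y N → Dec (Settled t Y N)
  settled? t Y N =
    t ≤? ∣ Y ∣ ⊎-dec
    (any? λ a → any? λ b → ¬? (a ≟ b) ×-dec 3 ≤? ∣ Y ∩ block a b ∣) ⊎-dec
    (any? λ i → i ∈? N ×-dec
      (all? λ a → all? λ b → ¬? (a ≟ b) →-dec i ∈? block a b →-dec ∣ ∁ N ∩ block a b ∣ ≤? 1))

  settled-sound : ∀ {t Y N S} → Settled t Y N → Y ⊆ S → S ⊆ ∁ N →
                  PairFree block S → PairSaturated block S → t ≤ ∣ S ∣
  settled-sound (inj₁ t≤∣Y∣) Y⊆S _ _ _ = ≤-trans t≤∣Y∣ (p⊆q⇒∣p∣≤∣q∣ Y⊆S)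
  settled-sound (inj₂ (inj₁ (a , b , a≢b , 3≤))) Y⊆S _ free _ =
    contradiction (≤-trans 3≤ (≤-trans (p⊆q⇒∣p∣≤∣q∣ (∩-monoˡ (block a b) Y⊆S)) (free a b a≢b)))
                  λ { (s≤s (s≤s ())) }
  settled-sound (inj₂ (inj₂ (i , i∈N , thin))) _ S⊆∁N _ saturated
    with saturated i (λ i∈S → x∈p⇒x∉∁p i∈N (S⊆∁N i∈S))
  ... | a , b , a≢b , i∈B , 2≤ =
    contradiction (≤-trans 2≤ (≤-trans (p⊆q⇒∣p∣≤∣q∣ (∩-monoˡ (block a b) S⊆∁N)) (thin a b a≢b i∈B)))
                  λ { (s≤s ()) }

  search  : ℕ → List (Fin m) → Subset m → Subset m → Bool
  branch  : ℕ → List (Fin m) → Subset m → Subset m → Bool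
  search t js Y N = does (settled? t Y N) ∨ branch t js Y N
  branch t []       Y N = false
  branch t (j ∷ js) Y N = search t js (Y ∪ ⁅ j ⁆) N ∧ search t js Y (N ∪ ⁅ j ⁆)

  search-sound : ∀ t js Y N {S} → search t js Y N ≡ true → Y ⊆ S → S ⊆ ∁ N →
                 PairFree block S → PairSaturated block S → t ≤ ∣ S ∣
  branch-sound : ∀ t js Y N {S} → branch t js Y N ≡ true → Y ⊆ S → S ⊆ ∁ N →
                 PairFree block S → PairSaturated block S → t ≤ ∣ S ∣

  search-sound t js Y N = sound-at (settled? t Y N)
    where
    sound-at : ∀ {S} (d : Dec (Settled t Y N)) → does d ∨ branch t js Y N ≡ true →
               Y ⊆ S → S ⊆ ∁ N → PairFree block S → PairSaturated block S → t ≤ ∣ S ∣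
    sound-at (yes settled) _  = settled-sound settled
    sound-at (no _)        ok = branch-sound t js Y N ok

  branch-sound t []       Y N ()
  branch-sound t (j ∷ js) Y N {S} ok Y⊆S S⊆∁N free saturated with j ∈? S
  ... | yes j∈S = search-sound t js (Y ∪ ⁅ j ⁆) N (∧-conicalˡ _ _ ok) Y+j⊆S S⊆∁N free saturated
    where
    Y+j⊆S : Y ∪ ⁅ j ⁆ ⊆ S
    Y+j⊆S {x} x∈ with x∈p∪q⁻ Y ⁅ j ⁆ x∈
    ... | inj₁ x∈Y = Y⊆S x∈Y
    ... | inj₂ x∈j = subst (_∈ S) (sym (x∈⁅y⁆⇒x≡y j x∈j)) j∈S
  ... | no  j∉S = search-sound t js Y (N ∪ ⁅ j ⁆) (∧-conicalʳ _ _ ok) Y⊆S S⊆∁N+j free saturated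
    where
    S⊆∁N+j : S ⊆ ∁ (N ∪ ⁅ j ⁆)
    S⊆∁N+j {x} x∈S = x∉p⇒x∈∁p λ x∈ → excluded (x∈p∪q⁻ N ⁅ j ⁆ x∈)
      where
      excluded : ¬ (x ∈ N ⊎ x ∈ ⁅ j ⁆)
      excluded (inj₁ x∈N) = x∈∁p⇒x∉p (S⊆∁N x∈S) x∈N
      excluded (inj₂ x∈j) = j∉S (subst (_∈ S) (x∈⁅y⁆⇒x≡y j x∈j) x∈S)

-- A family of subsets of the row set is a subset of the cube; the block of a
-- pair a, b consists of the vectors with ones in both a and b.
coverTable : ∀ n → Vec (Vec (Subset (2 ^ n)) n) n
coverTable n = tabulate λ a → tabulate λ b → tabulate λ i → bothOnes (decode n i) a b

cover : Blocks (2 ^ n) n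
cover {n} = Search.block (coverTable n)

cover-tabulate : ∀ (a b : Fin n) → cover a b ≡ tabulate λ i → bothOnes (decode n i) a b
cover-tabulate {n} a b = begin
  lookup (lookup (coverTable n) a) b
    ≡⟨ cong (λ row → lookup row b) (lookup∘tabulate _ a) ⟩
  lookup (tabulate λ b → tabulate λ i → bothOnes (decode n i) a b) b
    ≡⟨ lookup∘tabulate _ b ⟩
  tabulate (λ i → bothOnes (decode n i) a b)
    ∎
  where open ≡-Reasoning

∈-cover⁺ : ∀ {a b : Fin n} {i} → bothOnes (decode n i) a b ≡ true → i ∈ cover a b
∈-cover⁺ {n} {a} {b} {i} ab =
  subst (i ∈_) (sym (cover-tabulate a b)) (∈-tabulate⁺ (λ i → bothOnes (decode n i) a b) ab)

∈-cover⁻ : ∀ {a b : Fin n} {i} → i ∈ cover a b → bothOnes (decode n i) a b ≡ true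
∈-cover⁻ {n} {a} {b} {i} i∈ =
  ∈-tabulate⁻ (λ i → bothOnes (decode n i) a b) (subst (i ∈_) (cover-tabulate a b) i∈)

-- The six vectors of weight at most one first (they lie in no block, so they
-- are forced into every pair-saturated family), then the rest in order.
lightFirst : ∀ n → List (Fin (2 ^ n))
lightFirst n = filter light? (allFin _) ++ filter (¬? ∘ light?) (allFin _)
  where
  light? = λ i → ∣ decode n i ∣ ≤? 1

family-bound : ∀ (S : Subset 32) → PairFree cover S → PairSaturated cover S → 12 ≤ ∣ S ∣
family-bound S = search-sound 12 (lightFirst 5) ⊥ ⊥ refl (λ x∈⊥ → contradiction x∈⊥ ∉⊥) (λ _ → x∉p⇒x∈∁p ∉⊥)
  where open Search (coverTable 5)

isColumn? : ∀ (M : Matrix n k) v → Dec (∃ λ j → M j ≡ v)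
isColumn? M v = any? λ j → ≡-dec Bool._≟_ (M j) v

columnSet : Matrix n k → Subset (2 ^ n)
columnSet {n} M = tabulate λ i → does (isColumn? M (decode n i))

column-of : ∀ (M : Matrix n k) {i} → i ∈ columnSet M → ∃ λ j → M j ≡ decode n i
column-of {n} M {i} i∈ =
  decided (isColumn? M (decode n i)) (∈-tabulate⁻ (λ i → does (isColumn? M (decode n i))) i∈)

encode-column∈ : ∀ (M : Matrix n k) j → encode n (M j) ∈ columnSet M
encode-column∈ {n} M j =
  ∈-tabulate⁺ (λ i → does (isColumn? M (decode n i)))
              (dec-true (isColumn? M _) (j , sym (decode-encode n (M j))))

column-of-injective : ∀ (M : Matrix n k) {i i'} (i∈ : i ∈ columnSet M) (i'∈ : i' ∈ columnSet M) →
                      proj₁ (column-of M i∈) ≡ proj₁ (column-of M i'∈) → i ≡ i'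
column-of-injective {n} M i∈ i'∈ e =
  decode-injective n (trans (sym (proj₂ (column-of M i∈)))
                            (trans (cong M e) (proj₂ (column-of M i'∈))))

columnSet-size : ∀ (M : Matrix n k) → ∣ columnSet M ∣ ≤ k
columnSet-size {k = k} M =
  subst (∣ columnSet M ∣ ≤_) (∣⊤∣≡n k)
    (≤∣∣-by-injection (λ i i∈ → proj₁ (column-of M i∈)) (column-of-injective M) (λ _ _ → ∈⊤))

column-of∈common : ∀ (M : Matrix n k) {a b : Fin n} {i} (i∈ : i ∈ columnSet M) →
                   i ∈ cover a b → proj₁ (column-of M i∈) ∈ common M a b
column-of∈common {n} M {a} {b} {i} i∈ i∈ab with column-of M i∈
... | j , Mj≡ = ∈-common⁺ M (∧-conicalˡ _ _ ab) (∧-conicalʳ _ _ ab)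
  where
  ab : bothOnes (M j) a b ≡ true
  ab = subst (λ v → bothOnes v a b ≡ true) (sym Mj≡) (∈-cover⁻ {a = a} {b} i∈ab)

columnSet-pairFree : ∀ (M : Matrix n k) → PairwiseSparse M → PairFree cover (columnSet M)
columnSet-pairFree M sparse a b a≢b =
  ≤-trans (≤∣∣-by-injection (λ i i∈ → proj₁ (column-of M (proj₁ (split i∈))))
                            (λ i∈ i'∈ → column-of-injective M (proj₁ (split i∈)) (proj₁ (split i'∈)))
                            (λ i i∈ → column-of∈common M (proj₁ (split i∈)) (proj₂ (split i∈))))
          (sparse a b a≢b)
  where
  split : ∀ {i} → i ∈ columnSet M ∩ cover a b → i ∈ columnSet M × i ∈ cover a b
  split = x∈p∩q⁻ (columnSet M) (cover a b)

-- ... and so does saturation: a non-member is a completable vector, and the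
-- common columns of its completing pair are members of the column set.
columnSet-pairSaturated : ∀ {n} (M : Matrix n k) → Simple M →
                          (∀ v → (∀ j → M j ≢ v) → Completable M v) →
                          PairSaturated (cover {n}) (columnSet M)
columnSet-pairSaturated {n = n} M simple completable i i∉ with completable (decode n i) new
  where
  new : ∀ j → M j ≢ decode n i
  new j Mj≡ = i∉ (∈-tabulate⁺ (λ i → does (isColumn? M (decode n i)))
                              (dec-true (isColumn? M (decode n i)) (j , Mj≡)))
... | a , b , a≢b , ab , 2≤ =
  a , b , a≢b , ∈-cover⁺ {a = a} {b} ab ,
  ≤-trans 2≤ (≤∣∣-by-injection (λ j _ → encode n (M j)) encode-inj encode∈)
  where
  encode-inj : ∀ {j j'} _ _ → encode n (M j) ≡ encode n (M j') → j ≡ j'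
  encode-inj {j} {j'} _ _ e =
    simple (trans (sym (decode-encode n (M j))) (trans (cong (decode n) e) (decode-encode n (M j'))))

  encode∈ : ∀ j → j ∈ common M a b → encode n (M j) ∈ columnSet M ∩ cover a b
  encode∈ j j∈ = x∈p∩q⁺ (encode-column∈ M j , ∈-cover⁺ {a = a} {b} ab')
    where
    ab' : bothOnes (decode n (encode n (M j))) a b ≡ true
    ab' = subst (λ v → bothOnes v a b ≡ true) (sym (decode-encode n (M j)))
                (∈-tabulate⁻ (λ j → bothOnes (M j) a b) j∈)

lower-bound : ∀ (M : Matrix 5 k) → Saturated threeT22 M → 12 ≤ k
lower-bound M saturated with saturated⇒counting M saturated
... | simple , sparse , completable =
  ≤-trans (family-bound (columnSet M) (columnSet-pairFree M sparse)
                        (columnSet-pairSaturated M simple completable))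
          (columnSet-size M)

simple? : ∀ (M : Matrix n k) → Dec (∀ i j → M i ≡ M j → i ≡ j)
simple? M = all? λ i → all? λ j → ≡-dec Bool._≟_ (M i) (M j) →-dec i ≟ j

sparse? : ∀ (M : Matrix n k) → Dec (PairwiseSparse M)
sparse? M = all? λ a → all? λ b → ¬? (a ≟ b) →-dec ∣ common M a b ∣ ≤? 2

completable? : ∀ (M : Matrix n k) v → Dec (Completable M v)
completable? M v =
  any? λ a → any? λ b → ¬? (a ≟ b) ×-dec bothOnes v a b Bool.≟ true ×-dec 2 ≤? ∣ common M a b ∣

completable-from-cube : ∀ (M : Matrix n k) →
                        (∀ i → (∃ λ j → M j ≡ decode n i) ⊎ Completable M (decode n i)) →
                        ∀ v → (∀ j → M j ≢ v) → Completable M v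
completable-from-cube {n} M cube v new with cube (encode n v)
... | inj₁ (j , Mj≡) = contradiction (trans Mj≡ (decode-encode n v)) (new j)
... | inj₂ completable = subst (Completable M) (decode-encode n v) completable

M12 : Matrix 5 12
M12 = lookup
  ( (false ∷ false ∷ false ∷ false ∷ false ∷ [])
  ∷ (true  ∷ false ∷ false ∷ false ∷ false ∷ [])
  ∷ (false ∷ true  ∷ false ∷ false ∷ false ∷ [])
  ∷ (false ∷ false ∷ true  ∷ false ∷ false ∷ [])
  ∷ (false ∷ false ∷ false ∷ true  ∷ false ∷ [])
  ∷ (false ∷ false ∷ false ∷ false ∷ true  ∷ [])
  ∷ (true  ∷ true  ∷ true  ∷ true  ∷ true  ∷ [])
  ∷ (true  ∷ true  ∷ true  ∷ true  ∷ false ∷ [])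
  ∷ (true  ∷ false ∷ false ∷ false ∷ true  ∷ [])
  ∷ (false ∷ true  ∷ false ∷ false ∷ true  ∷ [])
  ∷ (false ∷ false ∷ true  ∷ false ∷ true  ∷ [])
  ∷ (false ∷ false ∷ false ∷ true  ∷ true  ∷ [])
  ∷ [])

M12-saturated : Saturated threeT22 M12
M12-saturated = counting⇒saturated M12
  ( (λ {i} {j} → decided (simple? M12) refl i j)
  , decided (sparse? M12) refl
  , completable-from-cube M12
      (decided (all? λ i → isColumn? M12 (decode 5 i) ⊎-dec completable? M12 (decode 5 i)) refl) )

mainTheorem8 : SatIs 5 threeT22 12
mainTheorem8 = (M12 , M12-saturated) , λ k M saturated → lower-bound M saturated
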